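{- If $\Gamma$ is a cc0-language, then the union of two components of $\Gamma$ is also a component of $\Gamma$.
   Context: $D$ is finite with distinguished $0$; $\Gamma$ is a set of relations on $D$. $\Gamma$ is a cc0-language if all its relations contain the all-zero tuple and every relation containing the all-zero tuple that is obtained from a relation of $\Gamma$ by substituting constants for some coordinates (fixing and deleting them) belongs to $\Gamma$. An endomorphism is a map $h:\mathrm{dom}(\Gamma)\to\mathrm{dom}(\Gamma)$ with $h(0)=0$ mapping (coordinatewise) every tuple of every $R\in\Gamma$ into $R$, where $\mathrm{dom}(\Gamma)$ is the set of values in tuples of $\Gamma$. For $X\subseteq D\setminus\{0\}$, the retraction $\mathrm{pr}_X$ maps $x\in X$ to $x$ and all other values to $0$. A nonempty $C\subseteq D\setminus\{0\}$ is a component of $\Gamma$ if $\mathrm{pr}_C$ is an endomorphism of $\Gamma$. -}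

module Defs where

open import Data.Nat using (ℕ; zero; suc)
open import Data.Fin using (Fin)
import Data.Fin as F
open import Data.Fin.Subset using (Subset; _∈_; _∪_; Nonempty)
open import Data.Vec using (Vec; []; _∷_; map; replicate; lookup)
open import Data.Maybe using (Maybe; just; nothing)
open import Data.Bool using (Bool; true; false; if_then_else_)
open import Data.Product using (Σ; _×_; ∃)
open import Relation.Binary.PropositionalEquality using (_≡_)
open import Relation.Nullary using (¬_)
open import Function.Bundles using (_⇔_)

Dom : ℕ → Set
Dom n = Fin (suc n)

𝟎 : ∀ {n} → Dom n
𝟎 = F.zero

Rel : ℕ → ℕ → Set₁
Rel n k = Vec (Dom n) k → Set

Lang : ℕ → Set₂
Lang n = (k : ℕ) → Rel n k → Set₁

zeros : ∀ {n} k → Vec (Dom n) k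
zeros k = replicate k 𝟎

-- A partial assignment of constants to the coordinates of a k-ary relation:
-- `just c` fixes the coordinate to c (and deletes it), `nothing` keeps it.
holes : ∀ {n k} → Vec (Maybe (Dom n)) k → ℕ
holes [] = zero
holes (just _ ∷ p) = holes p
holes (nothing ∷ p) = suc (holes p)

fill : ∀ {n k} (p : Vec (Maybe (Dom n)) k) → Vec (Dom n) (holes p) → Vec (Dom n) k
fill [] u = []
fill (just c ∷ p) u = c ∷ fill p u
fill (nothing ∷ p) (x ∷ u) = x ∷ fill p u

subst : ∀ {n k} → Rel n k → (p : Vec (Maybe (Dom n)) k) → Rel n (holes p)
subst R p u = R (fill p u)

-- Γ contains a relation (up to extensional equality of predicates).
_∈Γ_ : ∀ {n k} → Rel n k → Lang n → Set₁
_∈Γ_ {n} {k} S Γ = Σ (Rel n k) λ R → Γ k R × (∀ t → R t ⇔ S t)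

IsCC0 : ∀ {n} → Lang n → Set₁
IsCC0 {n} Γ =
  (∀ k R → Γ k R → R (zeros k))
  × (∀ k R → Γ k R → (p : Vec (Maybe (Dom n)) k) →
       subst R p (zeros (holes p)) → subst R p ∈Γ Γ)

-- Endomorphism: h(0) = 0 and h maps every tuple of every R ∈ Γ into R.
-- (Only values from dom(Γ) are ever used, so taking h total on D is harmless.)
IsEndo : ∀ {n} → Lang n → (Dom n → Dom n) → Set₁
IsEndo {n} Γ h = (h 𝟎 ≡ 𝟎) × (∀ k R → Γ k R → ∀ t → R t → R (map h t))

pr : ∀ {n} → Subset (suc n) → Dom n → Dom n
pr X x = if lookup X x then x else 𝟎

IsComponent : ∀ {n} → Lang n → Subset (suc n) → Set₁
IsComponent Γ C = Nonempty C × ¬ (𝟎 ∈ C) × IsEndo Γ (pr C)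

module Submission where

-- Write h = pr (C₁ ∪ C₂).  Pointwise, h x is x when x ∈ C₁ and
-- pr C₂ x otherwise, so h applies pr C₂ to the coordinates of a tuple that
-- are outside C₁ and leaves the others fixed.  To see that this preserves
-- R ∈ Γ at a tuple t ∈ R, substitute the C₁-coordinates of t as constants.
-- The resulting relation R' contains the all-zero tuple, because
-- pr C₁ t ∈ R; hence R' ∈ Γ by the cc0 property.  The free coordinates of t
-- form a tuple of R', so pr C₂ maps them into R', which after filling the
-- constants back in is exactly h t ∈ R.

open import Defs
open import Data.Nat using (ℕ; suc)
open import Data.Fin.Subset using (Subset; _∪_; _∈_)
open import Data.Fin.Subset.Properties using (x∈p∪q⁻; p⊆p∪q)
open import Data.Vec using (Vec; []; _∷_; map; lookup)
open import Data.Vec.Properties using (map-cong; map-const; map-id; lookup-zipWith)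
open import Data.Maybe using (Maybe; just; nothing)
open import Data.Bool using (Bool; true; false; if_then_else_; _∨_)
open import Data.Product using (_,_)
open import Data.Sum using ([_,_])
open import Function using (const; id)
open import Function.Bundles using (Equivalence)
open import Relation.Nullary using (¬_)
open import Relation.Binary.PropositionalEquality
  using (_≡_; refl; sym; cong; module ≡-Reasoning)
import Relation.Binary.PropositionalEquality as Eq

Preserves : ∀ {n} → Lang n → (Dom n → Dom n) → Set₁
Preserves {n} Γ h = ∀ k (R : Rel n k) → Γ k R → ∀ t → R t → R (map h t)

_▷_ : ∀ {n} → (Dom n → Bool) → (Dom n → Dom n) → Dom n → Dom n
(g ▷ h) x = if g x then x else h x

module Split {n : ℕ} (g : Dom n → Bool) where

  frozen : ∀ {k} → Vec (Dom n) k → Vec (Maybe (Dom n)) k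
  frozen [] = []
  frozen (x ∷ t) with g x
  ... | true  = just x ∷ frozen t
  ... | false = nothing ∷ frozen t

  free : ∀ {k} (t : Vec (Dom n) k) → Vec (Dom n) (holes (frozen t))
  free [] = []
  free (x ∷ t) with g x
  ... | true  = free t
  ... | false = x ∷ free t

  fill-map : ∀ (h : Dom n → Dom n) {k} (t : Vec (Dom n) k) →
    fill (frozen t) (map h (free t)) ≡ map (g ▷ h) t
  fill-map h [] = refl
  fill-map h (x ∷ t) with g x
  ... | true  = cong (x ∷_) (fill-map h t)
  ... | false = cong (h x ∷_) (fill-map h t)

  fill-free : ∀ {k} (t : Vec (Dom n) k) → fill (frozen t) (free t) ≡ t
  fill-free t = begin
    fill (frozen t) (free t)          ≡⟨ cong (fill (frozen t)) (sym (map-id (free t))) ⟩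
    fill (frozen t) (map id (free t)) ≡⟨ fill-map id t ⟩
    map (g ▷ id) t                    ≡⟨ map-cong ▷-id t ⟩
    map id t                          ≡⟨ map-id t ⟩
    t                                 ∎
    where
    open ≡-Reasoning
    ▷-id : ∀ x → (g ▷ id) x ≡ x
    ▷-id x with g x
    ... | true  = refl
    ... | false = refl

  fill-zeros : ∀ {k} (t : Vec (Dom n) k) →
    fill (frozen t) (zeros (holes (frozen t))) ≡ map (g ▷ const 𝟎) t
  fill-zeros t = begin
    fill (frozen t) (zeros _)                 ≡⟨ cong (fill (frozen t)) (sym (map-const (free t) 𝟎)) ⟩
    fill (frozen t) (map (const 𝟎) (free t))  ≡⟨ fill-map (const 𝟎) t ⟩
    map (g ▷ const 𝟎) t                       ∎
    where open ≡-Reasoning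

glue : ∀ {n} (Γ : Lang n) → IsCC0 Γ → (g : Dom n → Bool) (h : Dom n → Dom n) →
  Preserves Γ h → ∀ k (R : Rel n k) → Γ k R → ∀ t →
  R t → R (map (g ▷ const 𝟎) t) → R (map (g ▷ h) t)
glue Γ (_ , closed) g h preserves k R R∈Γ t t∈R zeroed∈R =
  from-closure (closed k R R∈Γ (frozen t) zeros∈R′)
  where
  open Split g
  zeros∈R′ : subst R (frozen t) (zeros (holes (frozen t)))
  zeros∈R′ = Eq.subst R (sym (fill-zeros t)) zeroed∈R

  from-closure : subst R (frozen t) ∈Γ Γ → R (map (g ▷ h) t)
  from-closure (R′ , R′∈Γ , R′⇔) =
    Eq.subst R (fill-map h t) (Equivalence.to (R′⇔ _) image∈R′)
    where
    free∈R′ : R′ (free t)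
    free∈R′ = Equivalence.from (R′⇔ (free t)) (Eq.subst R (sym (fill-free t)) t∈R)
    image∈R′ : R′ (map h (free t))
    image∈R′ = preserves _ R′ R′∈Γ (free t) free∈R′

pr-𝟎 : ∀ {n} (X : Subset (suc n)) → pr X 𝟎 ≡ 𝟎
pr-𝟎 X with lookup X 𝟎
... | true  = refl
... | false = refl

pr-∪ : ∀ {n} (C₁ C₂ : Subset (suc n)) (x : Dom n) →
  pr (C₁ ∪ C₂) x ≡ (lookup C₁ ▷ pr C₂) x
pr-∪ C₁ C₂ x rewrite lookup-zipWith _∨_ x C₁ C₂ with lookup C₁ x
... | true  = refl
... | false = refl

-- Nonemptiness comes from C₁, the absence of 𝟎
-- from both, and preservation of Γ from gluing pr C₂ onto the part outside
-- C₁; the zeroing hypothesis of the gluing lemma is preservation by pr C₁,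
-- since pr C₁ is lookup C₁ ▷ const 𝟎 by definition.
proposition3p15 : {n : ℕ} (Γ : Lang n) → IsCC0 Γ →
    (C₁ C₂ : Subset (suc n)) → IsComponent Γ C₁ → IsComponent Γ C₂ →
    IsComponent Γ (C₁ ∪ C₂)
proposition3p15 Γ cc0 C₁ C₂ ((x , x∈C₁) , 𝟎∉C₁ , _ , pres₁) (_ , 𝟎∉C₂ , _ , pres₂) =
  (x , p⊆p∪q C₂ x∈C₁) , 𝟎∉C₁∪C₂ , pr-𝟎 (C₁ ∪ C₂) , pres∪
  where
  𝟎∉C₁∪C₂ : ¬ (𝟎 ∈ C₁ ∪ C₂)
  𝟎∉C₁∪C₂ 𝟎∈C₁∪C₂ = [ 𝟎∉C₁ , 𝟎∉C₂ ] (x∈p∪q⁻ C₁ C₂ 𝟎∈C₁∪C₂)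

  pres∪ : Preserves Γ (pr (C₁ ∪ C₂))
  pres∪ k R R∈Γ t t∈R =
    Eq.subst R (sym (map-cong (pr-∪ C₁ C₂) t))
      (glue Γ cc0 (lookup C₁) (pr C₂) pres₂ k R R∈Γ t t∈R (pres₁ k R R∈Γ t t∈R))
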